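{- Let $w\in S_n$. For any $y\in S_n$ we have $\mathrm{rk}_y\ge\mathrm{rk}_w$ on the influence set $\mathcal{I}^w(\{(i,j)\in\Box:\mathrm{rk}_w(i,j)=\mathrm{rk}_y(i,j)\})$.
   Context: $S_n$ is the symmetric group on $\{1,\dots,n\}$ and $\Box=\{0,\dots,n\}\times\{0,\dots,n\}$. For $w\in S_n$ and $(i,j)\in\Box$, $\mathrm{rk}_w(i,j)=\#\{u\in\{1,\dots,i\}:w(u)\le j\}$. For $p=(i,j),p'=(i',j')\in\Box$ put $\mathrm{cr}(p,p')=\{(i,j'),(i',j)\}$ and $D_w(p,p')=\mathrm{rk}_w(p)+\mathrm{rk}_w(p')-\mathrm{rk}_w(i,j')-\mathrm{rk}_w(i',j)$. Write $p\bowtie p'$ if $(i'-i)(j'-j)>0$. For $A,B\subset\Box$ define $C^w_A(B)=B\cup\{p\in\Box:\exists p'\in A \text{ with } p\bowtie p',\ D_w(p,p')=0,\ \mathrm{cr}(p,p')\subset B\}$. For $A\subset\Box$ define $A_0=A$, $A_k=C^w_A(A_{k-1})$ for $k>0$, and the influence set $\mathcal{I}^w(A)=\bigcup_{k\ge0}A_k$. -}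

module Defs where

open import Data.Nat using (ℕ; zero; suc; _+_; _<_; _<ᵇ_)
open import Data.Bool using (Bool; _∧_)
open import Data.Fin using (Fin; toℕ)
open import Data.Fin.Permutation using (Permutation′; _⟨$⟩ʳ_)
open import Data.List using (List; length; filterᵇ; allFin)
open import Data.Product using (_×_; _,_; Σ; ∃)
open import Data.Sum using (_⊎_)
open import Relation.Binary.PropositionalEquality using (_≡_)

Box : ℕ → Set
Box n = Fin (suc n) × Fin (suc n)

-- S_n is realised as Permutation′ n on Fin n; the element u ∈ {1,…,n}
-- corresponds to the Fin n element with toℕ = u - 1.
-- rk_w(i,j) = #{u ∈ {1..i} : w(u) ≤ j}
--           = #{u : Fin n | toℕ u < i and toℕ (w u) < j}
rk : ∀ {n} → Permutation′ n → ℕ → ℕ → ℕ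
rk {n} w i j = length (filterᵇ (λ u → (toℕ u <ᵇ i) ∧ (toℕ (w ⟨$⟩ʳ u) <ᵇ j)) (allFin n))

rkB : ∀ {n} → Permutation′ n → Box n → ℕ
rkB w (i , j) = rk w (toℕ i) (toℕ j)

_⋈_ : ∀ {n} → Box n → Box n → Set
(i , j) ⋈ (i' , j') =
  (toℕ i < toℕ i' × toℕ j < toℕ j') ⊎ (toℕ i' < toℕ i × toℕ j' < toℕ j)

-- D_w(p,p') = 0, stated additively in ℕ:
-- rk(p) + rk(p') = rk(i,j') + rk(i',j)
D≡0 : ∀ {n} → Permutation′ n → Box n → Box n → Set
D≡0 w (i , j) (i' , j') =
  rkB w (i , j) + rkB w (i' , j') ≡ rkB w (i , j') + rkB w (i' , j)

Subset : ℕ → Set₁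
Subset n = Box n → Set

C : ∀ {n} → Permutation′ n → Subset n → Subset n → Subset n
C {n} w A B p =
  B p ⊎ Σ (Box n) (λ p' → A p' × p ⋈ p' × D≡0 w p p'
          × B (Data.Product.proj₁ p , Data.Product.proj₂ p')
          × B (Data.Product.proj₁ p' , Data.Product.proj₂ p))

iter : ∀ {n} → Permutation′ n → Subset n → ℕ → Subset n
iter w A zero = A
iter w A (suc k) = C w A (iter w A k)

Influence : ∀ {n} → Permutation′ n → Subset n → Subset n
Influence w A p = ∃ (λ k → iter w A k p)

Agree : ∀ {n} → Permutation′ n → Permutation′ n → Subset n
Agree w y p = rkB w p ≡ rkB y p

module Submission where

-- Counting the
-- elements u one at a time, the indicator [u < i ∧ y(u) < j] is supermodular in
-- (i,j), hence so is rk_y: for i ≤ i' and j ≤ j',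
--     rk_y(i,j') + rk_y(i',j) ≤ rk_y(i,j) + rk_y(i',j'),
-- i.e. D_y(p,p') ≥ 0 whenever p ⋈ p'.  Now suppose p' lies in the agreement set
-- A = {rk_w = rk_y}, D_w(p,p') = 0 and rk_w ≤ rk_y at both crossing points.
-- Then rk_w(p) + rk_y(p') = rk_w(p) + rk_w(p') = rk_w(crossings)
-- ≤ rk_y(crossings) ≤ rk_y(p) + rk_y(p'), so rk_w(p) ≤ rk_y(p).  Induction on
-- the stage k of the construction A_k then shows rk_w ≤ rk_y on every A_k,
-- hence on the influence set.

open import Defs
open import Data.Bool using (Bool; true; false; _∧_; T)
open import Data.Bool.Properties using (∧-zeroʳ)
open import Data.Fin using (toℕ)
open import Data.Fin.Permutation using (Permutation′; _⟨$⟩ʳ_)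
open import Data.List using (List; []; _∷_; length; filterᵇ; allFin)
open import Data.Nat using (ℕ; suc; _≤_; _+_; _<ᵇ_; z≤n)
open import Data.Nat.Solver using (module +-*-Solver)
open import Data.Nat.Properties
  using (≤-refl; ≤-reflexive; ≤-trans; <⇒≤; <ᵇ⇒<; <⇒<ᵇ; +-comm; +-mono-≤;
         +-cancelʳ-≤; module ≤-Reasoning)
open import Data.Product using (_,_)
open import Data.Sum using (inj₁; inj₂)
open import Relation.Binary.PropositionalEquality using (_≡_; refl; sym; cong; cong₂)

indicator : Bool → ℕ
indicator true  = 1
indicator false = 0

count-∷ : ∀ {A : Set} (p : A → Bool) (x : A) (xs : List A) →
  length (filterᵇ p (x ∷ xs)) ≡ indicator (p x) + length (filterᵇ p xs)
count-∷ p x xs with p x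
... | true  = refl
... | false = refl

indicator-supermodular : ∀ a a' b b' → (T a → T a') → (T b → T b') →
  indicator (a ∧ b') + indicator (a' ∧ b) ≤ indicator (a ∧ b) + indicator (a' ∧ b')
indicator-supermodular true a' b b' a⇒a' _ with a' | a⇒a' _
... | true | _ = ≤-reflexive (+-comm (indicator b') (indicator b))
indicator-supermodular false a' true b' _ b⇒b' with b' | b⇒b' _
... | true | _ = ≤-refl
indicator-supermodular false a' false b' _ _
  rewrite ∧-zeroʳ a' = z≤n

+-interchange : ∀ a b c d → (a + b) + (c + d) ≡ (a + c) + (b + d)
+-interchange a b c d = solve 4 (λ a b c d → (a :+ b) :+ (c :+ d) := (a :+ c) :+ (b :+ d)) refl a b c d
  where open +-*-Solver

count-supermodular : ∀ {A : Set} (a a' b b' : A → Bool) →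
  (∀ x → T (a x) → T (a' x)) → (∀ x → T (b x) → T (b' x)) → (xs : List A) →
  length (filterᵇ (λ x → a x ∧ b' x) xs) + length (filterᵇ (λ x → a' x ∧ b x) xs)
  ≤ length (filterᵇ (λ x → a x ∧ b x) xs) + length (filterᵇ (λ x → a' x ∧ b' x) xs)
count-supermodular a a' b b' a⇒a' b⇒b' [] = ≤-refl
count-supermodular a a' b b' a⇒a' b⇒b' (x ∷ xs) = begin
    count (x ∷ xs) ab' + count (x ∷ xs) a'b
  ≡⟨ cong₂ _+_ (count-∷ ab' x xs) (count-∷ a'b x xs) ⟩
    (indicator (ab' x) + count xs ab') + (indicator (a'b x) + count xs a'b)
  ≡⟨ +-interchange (indicator (ab' x)) _ _ _ ⟩
    (indicator (ab' x) + indicator (a'b x)) + (count xs ab' + count xs a'b)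
  ≤⟨ +-mono-≤ (indicator-supermodular (a x) (a' x) (b x) (b' x) (a⇒a' x) (b⇒b' x))
              (count-supermodular a a' b b' a⇒a' b⇒b' xs) ⟩
    (indicator (ab x) + indicator (a'b' x)) + (count xs ab + count xs a'b')
  ≡⟨ +-interchange (indicator (ab x)) _ _ _ ⟩
    (indicator (ab x) + count xs ab) + (indicator (a'b' x) + count xs a'b')
  ≡⟨ sym (cong₂ _+_ (count-∷ ab x xs) (count-∷ a'b' x xs)) ⟩
    count (x ∷ xs) ab + count (x ∷ xs) a'b'
  ∎
  where
    open ≤-Reasoning
    count : List _ → (_ → Bool) → ℕ
    count ys p = length (filterᵇ p ys)
    ab ab' a'b a'b' : _ → Bool
    ab   x = a x ∧ b x
    ab'  x = a x ∧ b' x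
    a'b  x = a' x ∧ b x
    a'b' x = a' x ∧ b' x

<ᵇ-monoʳ : ∀ m {i i'} → i ≤ i' → T (m <ᵇ i) → T (m <ᵇ i')
<ᵇ-monoʳ m i≤i' m<i = <⇒<ᵇ (≤-trans (<ᵇ⇒< m _ m<i) i≤i')

rk-supermodular : ∀ {n} (w : Permutation′ n) {i i' j j'} → i ≤ i' → j ≤ j' →
  rk w i j' + rk w i' j ≤ rk w i j + rk w i' j'
rk-supermodular {n} w {i} {i'} {j} {j'} i≤i' j≤j' =
  count-supermodular (λ u → toℕ u <ᵇ i) (λ u → toℕ u <ᵇ i')
                     (λ u → toℕ (w ⟨$⟩ʳ u) <ᵇ j) (λ u → toℕ (w ⟨$⟩ʳ u) <ᵇ j')
                     (λ u → <ᵇ-monoʳ (toℕ u) i≤i') (λ u → <ᵇ-monoʳ (toℕ (w ⟨$⟩ʳ u)) j≤j')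
                     (allFin n)

rkB-crossing≤ : ∀ {n} (w : Permutation′ n) {i j i' j'} → (i , j) ⋈ (i' , j') →
  rkB w (i , j') + rkB w (i' , j) ≤ rkB w (i , j) + rkB w (i' , j')
rkB-crossing≤ w (inj₁ (i<i' , j<j')) = rk-supermodular w (<⇒≤ i<i') (<⇒≤ j<j')
rkB-crossing≤ w {i} {j} {i'} {j'} (inj₂ (i'<i , j'<j)) = begin
    rkB w (i , j') + rkB w (i' , j)  ≡⟨ +-comm (rkB w (i , j')) _ ⟩
    rkB w (i' , j) + rkB w (i , j')  ≤⟨ rk-supermodular w (<⇒≤ i'<i) (<⇒≤ j'<j) ⟩
    rkB w (i' , j') + rkB w (i , j)  ≡⟨ +-comm (rkB w (i' , j')) _ ⟩
    rkB w (i , j) + rkB w (i' , j')  ∎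
  where open ≤-Reasoning

propagate : ∀ {n} (w y : Permutation′ n) {i j i' j'} →
  Agree w y (i' , j') → (i , j) ⋈ (i' , j') → D≡0 w (i , j) (i' , j') →
  rkB w (i , j') ≤ rkB y (i , j') → rkB w (i' , j) ≤ rkB y (i' , j) →
  rkB w (i , j) ≤ rkB y (i , j)
propagate w y {i} {j} {i'} {j'} agree p⋈p' D≡0 ≤₁ ≤₂ =
  +-cancelʳ-≤ (rkB y (i' , j')) _ _ (begin
    rkB w (i , j) + rkB y (i' , j')   ≡⟨ cong (rkB w (i , j) +_) (sym agree) ⟩
    rkB w (i , j) + rkB w (i' , j')   ≡⟨ D≡0 ⟩
    rkB w (i , j') + rkB w (i' , j)   ≤⟨ +-mono-≤ ≤₁ ≤₂ ⟩
    rkB y (i , j') + rkB y (i' , j)   ≤⟨ rkB-crossing≤ y p⋈p' ⟩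
    rkB y (i , j) + rkB y (i' , j')   ∎)
  where open ≤-Reasoning

rk≤-on-stage : ∀ {n} (w y : Permutation′ n) (k : ℕ) (p : Box n) →
  iter w (Agree w y) k p → rkB w p ≤ rkB y p
rk≤-on-stage w y 0       p       agree          = ≤-reflexive agree
rk≤-on-stage w y (suc k) p       (inj₁ earlier) = rk≤-on-stage w y k p earlier
rk≤-on-stage w y (suc k) _       (inj₂ (_ , agree , p⋈p' , D≡0 , cross₁ , cross₂)) =
  propagate w y agree p⋈p' D≡0 (rk≤-on-stage w y k _ cross₁) (rk≤-on-stage w y k _ cross₂)

corollary2p6 : (n : ℕ) (w y : Permutation′ n) (p : Box n) →
    Influence w (Agree w y) p → rkB w p ≤ rkB y p
corollary2p6 n w y p (k , p∈A_k) = rk≤-on-stage w y k p p∈A_k
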